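{- Let $\mathcal I$ be a canonical instance, $P$ a good assignment of private items, and $\alpha\ge 1$. An integral $\alpha$-feasible flow in $N(\mathcal{I},P)$ gives an $\alpha$-approximate solution for $\mathcal{I}$, i.e., an assignment of items in which every heavy agent $A$ receives an item of $\Gamma(A)$ and every light agent $A$ receives $h(A)$ or at least $N_A/\alpha$ items of $S(A)$.
   Context: Canonical instance: value $M$; agents partitioned into light agents $L$ and heavy agents $H$; each heavy agent $A$ has a set $\Gamma(A)$ of items of utility $M$; each light agent $A$ has a distinct heavy item $h(A)$ of utility $M$, an integer $N_A$, and a set $S(A)$ of items of utility $M/N_A$. A good assignment of private items $P$: each light agent $A$ gets $P(A)=h(A)$; each item is private for at most one agent; some heavy agents $A$ get a private item $P(A)\in\Gamma(A)$; the heavy agents without private items are terminals $T$; $S$ is the set of items that are nobody's private item. The directed network $N(\mathcal I,P)$ has vertices $\mathcal A\cup I\cup\{s\}$ and edges $s\to i$ ($i\in S$); $A\to P(A)$ for agents with private items; $i\to A$ for heavy $A$ and $i\in\Gamma(A)\setminus\{P(A)\}$; $i\to A$ for light $A$ and $i\in S(A)$. An integral flow is $\alpha$-feasible if: all flow originates at $s$; each terminal receives exactly one unit; for each non-terminal heavy agent and each item, in-flow and out-flow are both $1$ or both $0$; for each light agent $A$, either the in-flow is at least $N_A/\alpha$ and the out-flow is $1$, or both are $0$.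
   Formalization: The parameter α ranges over the rationals with α ≥ 1. -}

module Defs where

open import Data.Nat using (ℕ; _≤_)
open import Data.Bool using (Bool; true; false)
open import Data.Fin using (Fin)
open import Data.Fin.Properties renaming (_≟_ to _≟ᶠ_)
open import Data.Maybe using (Maybe; just; nothing)
open import Data.Maybe.Properties using (≡-dec)
open import Data.List using (List; _∷_; _++_; map; filter; length; allFin)
open import Data.Nat.ListAction using (sum)
open import Data.Integer using (+_)
open import Data.Rational using (ℚ; _/_) renaming (_≤_ to _≤ℚ_; _*_ to _*ℚ_)
open import Data.Product using (Σ; _×_; ∃; ∃-syntax)
open import Data.Sum using (_⊎_)
open import Data.Empty using (⊥)
open import Relation.Nullary using (¬_)
open import Relation.Nullary.Decidable using (_×-dec_)
open import Relation.Binary.PropositionalEquality using (_≡_; _≢_)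
import Data.Bool.Properties as BP

ℕ→ℚ : ℕ → ℚ
ℕ→ℚ n = (+ n) / 1

-- A canonical instance with nA agents (Fin nA) and nI items (Fin nI).
-- light A ≡ true : A ∈ L ; light A ≡ false : A ∈ H.
-- Γ A i        : i ∈ Γ(A)   (used for heavy A)
-- h A, N A, S A : h(A), N_A, S(A) (used for light A)
-- Utilities (M, M/N_A) are not needed for the combinatorial statement.
record Canonical (nA nI : ℕ) : Set where
  field
    light : Fin nA → Bool
    Γ     : Fin nA → Fin nI → Bool
    h     : Fin nA → Fin nI
    N     : Fin nA → ℕ
    S     : Fin nA → Fin nI → Bool
    h-distinct : ∀ A B → light A ≡ true → light B ≡ true → h A ≡ h B → A ≡ B
    N-pos : ∀ A → light A ≡ true → 1 ≤ N A

module _ {nA nI : ℕ} (I : Canonical nA nI) where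
  open Canonical I

  -- P A ≡ just i : i is the private item of A ; nothing : A has no private item
  record GoodAssignment (P : Fin nA → Maybe (Fin nI)) : Set where
    field
      light-private : ∀ A → light A ≡ true → P A ≡ just (h A)
      private-unique : ∀ A B i → P A ≡ just i → P B ≡ just i → A ≡ B
      heavy-private : ∀ A i → light A ≡ false → P A ≡ just i → Γ A i ≡ true

  module Network (P : Fin nA → Maybe (Fin nI)) where

    Terminal : Fin nA → Set
    Terminal A = light A ≡ false × P A ≡ nothing

    Free : Fin nI → Set
    Free i = ∀ A → P A ≢ just i

    data V : Set where
      src : V
      ag  : Fin nA → V
      it  : Fin nI → V

    allV : List V
    allV = src ∷ (map ag (allFin nA) ++ map it (allFin nI))

    Edge : V → V → Set
    Edge src (it i) = Free i
    Edge (ag A) (it i) = P A ≡ just i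
    Edge (it i) (ag A) =
      (light A ≡ false × Γ A i ≡ true × P A ≢ just i)
      ⊎ (light A ≡ true × S A i ≡ true)
    Edge _ _ = ⊥

    Flow : Set
    Flow = V → V → ℕ

    inflow : Flow → V → ℕ
    inflow f v = sum (map (λ u → f u v) allV)

    outflow : Flow → V → ℕ
    outflow f v = sum (map (λ w → f v w) allV)

    BothOneOrZero : ℕ → ℕ → Set
    BothOneOrZero a b = (a ≡ 1 × b ≡ 1) ⊎ (a ≡ 0 × b ≡ 0)

    -- α-feasibility.  "in-flow ≥ N_A/α" is written N_A ≤ α · in-flow (α ≥ 1 > 0).
    record AlphaFeasible (α : ℚ) (f : Flow) : Set where
      field
        on-edges  : ∀ u v → ¬ Edge u v → f u v ≡ 0
        terminal  : ∀ A → Terminal A → inflow f (ag A) ≡ 1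
        heavy     : ∀ A → light A ≡ false → P A ≢ nothing →
                    BothOneOrZero (inflow f (ag A)) (outflow f (ag A))
        item      : ∀ i → BothOneOrZero (inflow f (it i)) (outflow f (it i))
        lightA    : ∀ A → light A ≡ true →
                    (ℕ→ℚ (N A) ≤ℚ (α *ℚ ℕ→ℚ (inflow f (ag A))) × outflow f (ag A) ≡ 1)
                    ⊎ (inflow f (ag A) ≡ 0 × outflow f (ag A) ≡ 0)

  Assignment : Set
  Assignment = Fin nI → Maybe (Fin nA)

  countS : Assignment → Fin nA → ℕ
  countS σ A = length (filter (λ i → (S A i BP.≟ true) ×-dec ≡-dec _≟ᶠ_ (σ i) (just A)) (allFin nI))

  ApproxSolution : ℚ → Assignment → Set
  ApproxSolution α σ =
    (∀ A → light A ≡ false → ∃[ i ] (σ i ≡ just A × Γ A i ≡ true))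
    × (∀ A → light A ≡ true →
         σ (h A) ≡ just A ⊎ ℕ→ℚ (N A) ≤ℚ (α *ℚ ℕ→ℚ (countS σ A)))

-- Give every item to the agent it sends flow to -- an item carries at most one unit, so
-- there is at most one such agent -- and otherwise to the agent holding it as private item.
-- A heavy agent with in-flow receives an item feeding it, which lies in Γ(A); a heavy agent
-- without in-flow has no out-flow, so its private item carries no flow and stays with it.
-- A light agent with in-flow receives every item feeding it, each from S(A) and carrying one
-- unit, hence at least N_A/α items of S(A); a light agent without flow keeps h(A).
module Submission where

open import Defs
open import Data.Nat using (ℕ)
open import Data.Fin using (Fin)
open import Data.Maybe using (Maybe)
open import Data.Rational using (ℚ; 1ℚ; _≤_)
open import Data.Product using (∃)

open import Data.Bool using (true; false)
import Data.Bool.Properties as BP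
open import Data.Empty using (⊥-elim)
open import Data.Fin.Properties using (any?) renaming (_≟_ to _≟ᶠ_)
open import Data.Integer as ℤ using (+_)
import Data.Integer.Properties as ℤP
open import Data.List using (List; []; _∷_; _++_; map; filter; length; allFin)
open import Data.List.Membership.Propositional using (_∈_)
open import Data.List.Membership.Propositional.Properties using (∈-map⁺; ∈-++⁺ˡ; ∈-++⁺ʳ; ∈-allFin)
open import Data.List.Properties using (map-++; map-∘)
open import Data.List.Relation.Unary.Any using (here; there)
open import Data.Maybe using (just; nothing; _<∣>_)
open import Data.Maybe.Properties using (≡-dec)
open import Data.Nat as Nat using (zero; suc; _+_; _<_; z≤n; s≤s; _<?_)
import Data.Nat.Properties as ℕP
open import Data.Nat.Coprimality using (1-coprimeTo) renaming (sym to coprime-sym)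
open import Data.Nat.ListAction using (sum)
open import Data.Nat.ListAction.Properties using (sum-++)
open import Data.Product using (_,_; _×_; proj₁; proj₂)
open import Data.Rational using (*≤*; NonNegative; nonNegative) renaming (_*_ to _*ℚ_)
import Data.Rational.Properties as ℚP
open import Data.Sum using (inj₁; inj₂; _⊎_; [_,_]′)
open import Function using (_∘_)
open import Relation.Binary.PropositionalEquality
open import Relation.Nullary using (¬_; Dec; yes; no; contradiction)
open import Relation.Nullary.Decidable using (_×-dec_; decidable-stable)
open import Relation.Unary using (Decidable)

ℕ→ℚ-mono-≤ : ∀ {m n} → m Nat.≤ n → ℕ→ℚ m ≤ ℕ→ℚ n
ℕ→ℚ-mono-≤ {m} {n} m≤n
  rewrite ℚP.normalize-coprime (coprime-sym (1-coprimeTo m))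
        | ℚP.normalize-coprime (coprime-sym (1-coprimeTo n)) =
  *≤* (subst₂ ℤ._≤_ (sym (ℤP.*-identityʳ (+ m))) (sym (ℤP.*-identityʳ (+ n))) (ℤ.+≤+ m≤n))

indicator : {Q : Set} → Dec Q → ℕ
indicator (yes _) = 1
indicator (no _)  = 0

≤-indicator : ∀ {Q : Set} (Q? : Dec Q) {n} → n Nat.≤ 1 → (0 < n → Q) → n Nat.≤ indicator Q?
≤-indicator (yes _) n≤1 _ = n≤1
≤-indicator (no _)  {zero} _ _ = z≤n
≤-indicator (no ¬q) {suc n} _ q = ⊥-elim (¬q (q (s≤s z≤n)))

module _ {X : Set} where

  ∈⇒≤sum-map : (g : X → ℕ) {x : X} {xs : List X} → x ∈ xs → g x Nat.≤ sum (map g xs)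
  ∈⇒≤sum-map g {xs = y ∷ ys} (here refl) = ℕP.m≤m+n (g y) _
  ∈⇒≤sum-map g {xs = y ∷ ys} (there x∈) = ℕP.≤-trans (∈⇒≤sum-map g x∈) (ℕP.m≤n+m _ (g y))

  distinct-∈⇒+≤sum-map : (g : X → ℕ) {x y : X} {xs : List X} → x ≢ y → x ∈ xs → y ∈ xs →
                         g x + g y Nat.≤ sum (map g xs)
  distinct-∈⇒+≤sum-map g x≢y (here refl) (here refl) = ⊥-elim (x≢y refl)
  distinct-∈⇒+≤sum-map g x≢y (here refl) (there y∈) = ℕP.+-monoʳ-≤ (g _) (∈⇒≤sum-map g y∈)
  distinct-∈⇒+≤sum-map g {x} {y} x≢y (there x∈) (here refl) =
    ℕP.≤-trans (ℕP.≤-reflexive (ℕP.+-comm (g x) (g y))) (ℕP.+-monoʳ-≤ (g y) (∈⇒≤sum-map g x∈))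
  distinct-∈⇒+≤sum-map g {xs = z ∷ _} x≢y (there x∈) (there y∈) =
    ℕP.≤-trans (distinct-∈⇒+≤sum-map g x≢y x∈ y∈) (ℕP.m≤n+m _ (g z))

  sum-map-mono : {g k : X → ℕ} → (∀ x → g x Nat.≤ k x) → (xs : List X) →
                 sum (map g xs) Nat.≤ sum (map k xs)
  sum-map-mono g≤k []       = z≤n
  sum-map-mono g≤k (x ∷ xs) = ℕP.+-mono-≤ (g≤k x) (sum-map-mono g≤k xs)

  sum-map-zero : {g : X → ℕ} → (∀ x → g x ≡ 0) → (xs : List X) → sum (map g xs) ≡ 0
  sum-map-zero g≡0 []       = refl
  sum-map-zero g≡0 (x ∷ xs) rewrite g≡0 x = sum-map-zero g≡0 xs

  sum-map-positive : (g : X → ℕ) (xs : List X) → 0 < sum (map g xs) → ∃ λ x → 0 < g x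
  sum-map-positive g (x ∷ xs) pos with g x in gx
  ... | zero  = sum-map-positive g xs pos
  ... | suc _ = x , subst (0 <_) (sym gx) (s≤s z≤n)

  sum-map-indicator≡length-filter : {Q : X → Set} (Q? : Decidable Q) (xs : List X) →
                                    sum (map (indicator ∘ Q?) xs) ≡ length (filter Q? xs)
  sum-map-indicator≡length-filter Q? [] = refl
  sum-map-indicator≡length-filter Q? (x ∷ xs) with Q? x
  ... | yes _ = cong suc (sum-map-indicator≡length-filter Q? xs)
  ... | no _  = sum-map-indicator≡length-filter Q? xs

module _ {n : ℕ} {Q : Fin n → Set} where

  witness : Dec (∃ Q) → Maybe (Fin n)
  witness (yes (x , _)) = just x
  witness (no _)        = nothing

  witness-unique : (Q? : Dec (∃ Q)) {x : Fin n} → Q x → (∀ y → Q y → y ≡ x) → witness Q? ≡ just x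
  witness-unique (yes (y , qy)) qx unique = cong just (unique y qy)
  witness-unique (no ¬∃)        qx _      = ⊥-elim (¬∃ (_ , qx))

  witness-none : (Q? : Dec (∃ Q)) → (∀ y → ¬ Q y) → witness Q? ≡ nothing
  witness-none (yes (y , qy)) none = ⊥-elim (none y qy)
  witness-none (no _)         _    = refl

module FeasibleFlow {nA nI : ℕ} (I : Canonical nA nI) (P : Fin nA → Maybe (Fin nI))
  (G : GoodAssignment I P) (α : ℚ) (f : Network.Flow I P) (F : Network.AlphaFeasible I P α f) where
  open Canonical I
  open GoodAssignment G
  open Network I P
  open AlphaFeasible F

  ag∈allV : ∀ A → ag A ∈ allV
  ag∈allV A = there (∈-++⁺ˡ (∈-map⁺ ag (∈-allFin A)))

  it∈allV : ∀ i → it i ∈ allV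
  it∈allV i = there (∈-++⁺ʳ (map ag (allFin nA)) (∈-map⁺ it (∈-allFin i)))

  onItems : (Fin nI → ℕ) → V → ℕ
  onItems g src    = 0
  onItems g (ag _) = 0
  onItems g (it i) = g i

  sum-map-onItems : (g : Fin nI → ℕ) → sum (map (onItems g) allV) ≡ sum (map g (allFin nI))
  sum-map-onItems g = begin
    sum (map (onItems g) (map ag as ++ map it is))
      ≡⟨ cong sum (map-++ (onItems g) (map ag as) (map it is)) ⟩
    sum (map (onItems g) (map ag as) ++ map (onItems g) (map it is))
      ≡⟨ sum-++ (map (onItems g) (map ag as)) (map (onItems g) (map it is)) ⟩
    sum (map (onItems g) (map ag as)) + sum (map (onItems g) (map it is))
      ≡⟨ cong₂ _+_ (trans (cong sum (sym (map-∘ as))) (sum-map-zero (λ _ → refl) as))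
                   (cong sum (sym (map-∘ is))) ⟩
    sum (map g is) ∎
    where
    open ≡-Reasoning
    as : List (Fin nA)
    as = allFin nA
    is : List (Fin nI)
    is = allFin nI

  flow-supported : ∀ u v → 0 < f u v → ¬ ¬ Edge u v
  flow-supported u v pos ¬edge = ℕP.<⇒≢ pos (sym (on-edges u v ¬edge))

  item-outflow-≤1 : ∀ i → outflow f (it i) Nat.≤ 1
  item-outflow-≤1 i with item i
  ... | inj₁ (_ , out≡1) = ℕP.≤-reflexive out≡1
  ... | inj₂ (_ , out≡0) = ℕP.≤-trans (ℕP.≤-reflexive out≡0) z≤n

  recipient-unique : ∀ i {A B} → 0 < f (it i) (ag A) → 0 < f (it i) (ag B) → B ≡ A
  recipient-unique i {A} {B} posA posB with B ≟ᶠ A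
  ... | yes B≡A = B≡A
  ... | no B≢A = ⊥-elim (ℕP.<⇒≱ (s≤s (s≤s z≤n)) (begin
    2                                  ≤⟨ ℕP.+-mono-≤ posA posB ⟩
    f (it i) (ag A) + f (it i) (ag B)  ≤⟨ distinct-∈⇒+≤sum-map (f (it i)) A≢B (ag∈allV A) (ag∈allV B) ⟩
    outflow f (it i)                   ≤⟨ item-outflow-≤1 i ⟩
    1                                  ∎))
    where
    open ℕP.≤-Reasoning
    A≢B : ag A ≢ ag B
    A≢B refl = B≢A refl

  flowAssignment : Assignment I
  flowAssignment i = witness (any? (λ B → 0 <? f (it i) (ag B)))
                 <∣> witness (any? (λ B → ≡-dec _≟ᶠ_ (P B) (just i)))

  flowAssignment-recipient : ∀ i A → 0 < f (it i) (ag A) → flowAssignment i ≡ just A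
  flowAssignment-recipient i A pos =
    cong (_<∣> _) (witness-unique (any? (λ B → 0 <? f (it i) (ag B))) pos (λ B → recipient-unique i pos))

  private-item-idle : ∀ A j → P A ≡ just j → outflow f (ag A) ≡ 0 → outflow f (it j) ≡ 0
  private-item-idle A j PA≡j out≡0 with item j
  ... | inj₂ (_ , out≡0′) = out≡0′
  ... | inj₁ (in≡1 , _)  = ⊥-elim (ℕP.1+n≢0 (trans (sym in≡1) (sum-map-zero no-inflow allV)))
    where
    no-inflow : ∀ u → f u (it j) ≡ 0
    no-inflow src    = on-edges src (it j) (λ free → free A PA≡j)
    no-inflow (it k) = on-edges (it k) (it j) (λ ())
    no-inflow (ag B) with B ≟ᶠ A
    ... | yes refl = ℕP.n≤0⇒n≡0 (ℕP.≤-trans (∈⇒≤sum-map (f (ag A)) (it∈allV j)) (ℕP.≤-reflexive out≡0))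
    ... | no B≢A  = on-edges (ag B) (it j) (λ PB≡j → B≢A (private-unique B A j PB≡j PA≡j))

  flowAssignment-private : ∀ A j → P A ≡ just j → outflow f (ag A) ≡ 0 → flowAssignment j ≡ just A
  flowAssignment-private A j PA≡j out≡0 = begin
    flowAssignment j
      ≡⟨ cong (_<∣> _) (witness-none (any? (λ B → 0 <? f (it j) (ag B))) no-recipient) ⟩
    witness (any? (λ B → ≡-dec _≟ᶠ_ (P B) (just j)))
      ≡⟨ witness-unique (any? (λ B → ≡-dec _≟ᶠ_ (P B) (just j))) PA≡j
           (λ B PB≡j → private-unique B A j PB≡j PA≡j) ⟩
    just A ∎
    where
    open ≡-Reasoning
    no-recipient : ∀ B → ¬ (0 < f (it j) (ag B))
    no-recipient B pos = ℕP.<⇒≱ pos (ℕP.≤-trans (∈⇒≤sum-map (f (it j)) (ag∈allV B))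
                                                  (ℕP.≤-reflexive (private-item-idle A j PA≡j out≡0)))

  supplier : ∀ A → 0 < inflow f (ag A) → ∃ λ i → 0 < f (it i) (ag A)
  supplier A pos with sum-map-positive (λ u → f u (ag A)) allV pos
  ... | src  , pos′ = ⊥-elim (flow-supported src (ag A) pos′ (λ ()))
  ... | ag B , pos′ = ⊥-elim (flow-supported (ag B) (ag A) pos′ (λ ()))
  ... | it i , pos′ = i , pos′

  heavy-supplier-Γ : ∀ A i → light A ≡ false → 0 < f (it i) (ag A) → Γ A i ≡ true
  heavy-supplier-Γ A i isHeavy pos = decidable-stable (Γ A i BP.≟ true) λ ¬Γ →
    flow-supported (it i) (ag A) pos λ
      { (inj₁ (_ , Γ , _)) → ¬Γ Γ
      ; (inj₂ (isLight , _)) → BP.not-¬ isLight isHeavy }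

  light-supplier-S : ∀ A i → light A ≡ true → 0 < f (it i) (ag A) → S A i ≡ true
  light-supplier-S A i isLight pos = decidable-stable (S A i BP.≟ true) λ ¬S →
    flow-supported (it i) (ag A) pos λ
      { (inj₁ (isHeavy , _)) → BP.not-¬ isLight isHeavy
      ; (inj₂ (_ , S)) → ¬S S }

  heavy-served-by-inflow : ∀ A → light A ≡ false → inflow f (ag A) ≡ 1 →
                          ∃ λ i → flowAssignment i ≡ just A × Γ A i ≡ true
  heavy-served-by-inflow A isHeavy in≡1 with supplier A (ℕP.≤-reflexive (sym in≡1))
  ... | i , pos = i , flowAssignment-recipient i A pos , heavy-supplier-Γ A i isHeavy pos

  heavy-served : ∀ A → light A ≡ false → ∃ λ i → flowAssignment i ≡ just A × Γ A i ≡ true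
  heavy-served A isHeavy with P A in PA
  ... | nothing = heavy-served-by-inflow A isHeavy (terminal A (isHeavy , PA))
  ... | just j with heavy A isHeavy (λ PA≡nothing → contradiction (trans (sym PA) PA≡nothing) λ ())
  ...   | inj₁ (in≡1 , _)  = heavy-served-by-inflow A isHeavy in≡1
  ...   | inj₂ (_ , out≡0) = j , flowAssignment-private A j PA out≡0 , heavy-private A j isHeavy PA

  light-inflow-≤-countS : ∀ A → light A ≡ true → inflow f (ag A) Nat.≤ countS I flowAssignment A
  light-inflow-≤-countS A isLight = begin
    inflow f (ag A)                              ≤⟨ sum-map-mono bound allV ⟩
    sum (map (onItems (indicator ∘ InS?)) allV)  ≡⟨ sum-map-onItems (indicator ∘ InS?) ⟩
    sum (map (indicator ∘ InS?) (allFin nI))     ≡⟨ sum-map-indicator≡length-filter InS? (allFin nI) ⟩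
    countS I flowAssignment A                    ∎
    where
    open ℕP.≤-Reasoning
    InS? : Decidable (λ i → S A i ≡ true × flowAssignment i ≡ just A)
    InS? i = (S A i BP.≟ true) ×-dec ≡-dec _≟ᶠ_ (flowAssignment i) (just A)
    bound : ∀ u → f u (ag A) Nat.≤ onItems (indicator ∘ InS?) u
    bound src    = ℕP.≤-reflexive (on-edges src (ag A) (λ ()))
    bound (ag B) = ℕP.≤-reflexive (on-edges (ag B) (ag A) (λ ()))
    bound (it i) = ≤-indicator (InS? i)
      (ℕP.≤-trans (∈⇒≤sum-map (f (it i)) (ag∈allV A)) (item-outflow-≤1 i))
      (λ pos → light-supplier-S A i isLight pos , flowAssignment-recipient i A pos)

  light-served : 1ℚ ≤ α → ∀ A → light A ≡ true →
                 flowAssignment (h A) ≡ just A ⊎ ℕ→ℚ (N A) ≤ (α *ℚ ℕ→ℚ (countS I flowAssignment A))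
  -- Case-splitting with 'with' here would abstract over countS in the goal, which is very slow.
  light-served 1≤α A isLight = [ inj₂ ∘ by-inflow ∘ proj₁ , inj₁ ∘ by-private ∘ proj₂ ]′ (lightA A isLight)
    where
    α≥0 : NonNegative α
    α≥0 = nonNegative (ℚP.≤-trans (ℚP.nonNegative⁻¹ 1ℚ) 1≤α)
    by-inflow : ℕ→ℚ (N A) ≤ (α *ℚ ℕ→ℚ (inflow f (ag A))) → ℕ→ℚ (N A) ≤ (α *ℚ ℕ→ℚ (countS I flowAssignment A))
    by-inflow N≤α·in = ℚP.≤-trans N≤α·in
      (ℚP.*-monoˡ-≤-nonNeg α {{α≥0}} (ℕ→ℚ-mono-≤ (light-inflow-≤-countS A isLight)))
    by-private : outflow f (ag A) ≡ 0 → flowAssignment (h A) ≡ just A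
    by-private = flowAssignment-private A (h A) (light-private A isLight)

lemma3 : {nA nI : ℕ} (I : Canonical nA nI) (P : Fin nA → Maybe (Fin nI)) →
         GoodAssignment I P → (α : ℚ) → 1ℚ ≤ α →
         (f : Network.Flow I P) → Network.AlphaFeasible I P α f →
         ∃ λ (σ : Assignment I) → ApproxSolution I α σ
lemma3 I P G α 1≤α f F = flowAssignment , heavy-served , light-served 1≤α
  where open FeasibleFlow I P G α f F
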